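{- Let $n\ge2$ and let $h\ge2$ be odd, with $\mu_0=\frac{h+1}{2}$. For every $p\in\mathcal{P}$, if $\mu(p)=\mu_0$ and $D_{\mu(p)}(p)=D_{\mu(p^r)}(p^r)$, then $\mu(p^r)>\mu_0$.
   Context: $N=\{1,\dots,n\}$, $H=\{1,\dots,h\}$, $\mathcal{P}=\mathcal{L}(N)^h$ the set of profiles of linear orders on $N$; $x>_{p_i}y$ means individual $i$ ranks $x$ above $y$; $p^r$ reverses each individual's order. For integers $\mu$ with $h/2<\mu\le h$: $D_\mu(p)=\{x\in N:\forall y,\ |\{i: y>_{p_i}x\}|<\mu\}$; $\mu(p)=\min\{\mu: D_\mu(p)\ne\varnothing\}$. -}

module Defs where

open import Data.Nat using (ℕ; _<_; _≤_; _*_)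
open import Data.Fin using (Fin)
import Data.Fin as F
open import Data.Fin.Properties using () renaming (_<?_ to _<ᶠ?_)
open import Data.Fin.Permutation using (Permutation′; _⟨$⟩ʳ_; _∘ₚ_; reverse)
open import Data.List using (List; length; filter)
open import Data.List.Base using (allFin)
open import Data.Product using (∃; _×_)
open import Relation.Nullary using (¬_)

-- A linear order on the alternatives N = Fin n, encoded as a ranking:
-- a bijection sending each alternative to its position (position 0 = top).
LinOrd : ℕ → Set
LinOrd n = Permutation′ n

_>[_]_ : ∀ {n} → Fin n → LinOrd n → Fin n → Set
x >[ σ ] y = σ ⟨$⟩ʳ x F.< σ ⟨$⟩ʳ y

Profile : ℕ → ℕ → Set
Profile n h = Fin h → LinOrd n

rev : ∀ {n h} → Profile n h → Profile n h
rev p i = p i ∘ₚ reverse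

supp : ∀ {n h} → Profile n h → Fin n → Fin n → ℕ
supp {h = h} p y x = length (filter (λ i → (p i ⟨$⟩ʳ y) <ᶠ? (p i ⟨$⟩ʳ x)) (allFin h))

InD : ∀ {n h} → ℕ → Profile n h → Fin n → Set
InD μ p x = ∀ y → supp p y x < μ

Admissible : ℕ → ℕ → Set
Admissible h μ = (h < 2 * μ) × (μ ≤ h)

IsMu : ∀ {n h} → Profile n h → ℕ → Set
IsMu {h = h} p m =
  Admissible h m × (∃ λ x → InD m p x) ×
  (∀ μ → Admissible h μ → μ < m → ∀ x → ¬ (InD μ p x))

-- Fix an alternative x with no majority against it in p (quota μ₀) nor in p^r,
-- and any other alternative y. Each individual ranks y above x in exactly one
-- of p and p^r, so the two opposition counts against x sum to h. Both being
-- below their quotas forces μ₀ + μ(p^r) ≥ h + 2, i.e. μ(p^r) > μ₀.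
module Submission where

open import Defs
open import Data.Nat using (ℕ; _<_; _≤_; _+_; _/_; _%_)
open import Data.Fin using (Fin)
open import Data.Product using (_×_)
open import Relation.Binary.PropositionalEquality using (_≡_)

open import Data.Nat using (suc; _*_; s≤s)
open import Data.Nat.Properties
  using (+-suc; +-comm; *-comm; +-identityʳ; +-mono-≤; +-cancelˡ-≤; ∸-monoʳ-<; <-asym; ≮⇒≥; module ≤-Reasoning)
open import Data.Nat.DivMod using (m/n*n≤m)
import Data.Fin as F
open import Data.Fin.Properties
  using (toℕ<n; opposite-prop; opposite-involutive; ≤∧≢⇒<; punchInᵢ≢i)
  renaming (_<?_ to _<ᶠ?_)
open import Data.Fin.Permutation using (_⟨$⟩ʳ_; _∘ₚ_; reverse)
open import Data.List using (List; []; _∷_; length; filter; allFin)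
open import Data.List.Properties using (filter-≐; length-tabulate)
open import Data.Product using (_,_; proj₁)
open import Function.Base using (_∘_)
open import Function.Bundles using (Injection)
open import Function.Properties.Inverse using (↔⇒↣)
open import Relation.Nullary using (¬_; yes; no)
open import Relation.Unary using (Pred; Decidable; ∁; _≐_)
open import Relation.Unary.Properties using (∁?)
open import Relation.Binary.PropositionalEquality using (_≢_; refl; sym; trans; cong; subst₂; module ≡-Reasoning)

opposite-< : ∀ {n} {i j : Fin n} → i F.< j → F.opposite j F.< F.opposite i
opposite-< {i = i} {j} i<j =
  subst₂ _<_ (sym (opposite-prop j)) (sym (opposite-prop i))
         (∸-monoʳ-< (s≤s i<j) (toℕ<n j))

opposite-<⁻¹ : ∀ {n} {i j : Fin n} → F.opposite j F.< F.opposite i → i F.< j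
opposite-<⁻¹ {i = i} {j} lt =
  subst₂ F._<_ (opposite-involutive i) (opposite-involutive j) (opposite-< lt)

length-filter+length-filter-∁ : ∀ {a p} {A : Set a} {P : Pred A p} (P? : Decidable P)
  (xs : List A) → length (filter P? xs) + length (filter (∁? P?) xs) ≡ length xs
length-filter+length-filter-∁ P? [] = refl
length-filter+length-filter-∁ P? (x ∷ xs) with P? x
... | yes _ = cong suc (length-filter+length-filter-∁ P? xs)
... | no  _ = trans (+-suc _ _) (cong suc (length-filter+length-filter-∁ P? xs))

module _ {n} (σ : LinOrd n) {x y : Fin n} where

  above-reversed⇒not-above : y >[ σ ∘ₚ reverse ] x → ¬ (y >[ σ ] x)
  above-reversed⇒not-above above-rev above = <-asym above (opposite-<⁻¹ above-rev)

  not-above⇒above-reversed : x ≢ y → ¬ (y >[ σ ] x) → y >[ σ ∘ₚ reverse ] x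
  not-above⇒above-reversed x≢y not-above =
    opposite-< (≤∧≢⇒< (≮⇒≥ not-above) (x≢y ∘ Injection.injective (↔⇒↣ σ)))

supp+supp-rev : ∀ {n h} (p : Profile n h) {x y : Fin n} → x ≢ y →
  supp p y x + supp (rev p) y x ≡ h
supp+supp-rev {h = h} p {x} {y} x≢y = begin
  supp p y x + supp (rev p) y x
    ≡⟨ cong (λ is → supp p y x + length is) (filter-≐ _ _ rev-above≐not-above (allFin h)) ⟩
  supp p y x + length (filter (∁? above?) (allFin h))
    ≡⟨ length-filter+length-filter-∁ above? (allFin h) ⟩
  length (allFin h)
    ≡⟨ length-tabulate (λ i → i) ⟩
  h ∎
  where
  open ≡-Reasoning
  above? : Decidable (λ i → y >[ p i ] x)
  above? = λ i → (p i ⟨$⟩ʳ y) <ᶠ? (p i ⟨$⟩ʳ x)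
  rev-above≐not-above : (λ i → y >[ rev p i ] x) ≐ ∁ (λ i → y >[ p i ] x)
  rev-above≐not-above =
    (λ {i} → above-reversed⇒not-above (p i)) , (λ {i} → not-above⇒above-reversed (p i) x≢y)

InD∧InD-rev⇒2+h≤μ+ν : ∀ {n h μ ν} (p : Profile n h) {x y : Fin n} → x ≢ y →
  InD μ p x → InD ν (rev p) x → 2 + h ≤ μ + ν
InD∧InD-rev⇒2+h≤μ+ν {h = h} {μ} {ν} p {x} {y} x≢y x∈D x∈Dʳ = begin
  2 + h                     ≡⟨ cong (2 +_) (sym (supp+supp-rev p x≢y)) ⟩
  2 + (s + sʳ)              ≡⟨ cong suc (sym (+-suc s sʳ)) ⟩
  suc s + suc sʳ            ≤⟨ +-mono-≤ (x∈D y) (x∈Dʳ y) ⟩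
  μ + ν                     ∎
  where
  open ≤-Reasoning
  s sʳ : ℕ
  s  = supp p y x
  sʳ = supp (rev p) y x

2+h≤[h+1]/2+ν⇒[h+1]/2<ν : ∀ h ν → 2 + h ≤ (h + 1) / 2 + ν → (h + 1) / 2 < ν
2+h≤[h+1]/2+ν⇒[h+1]/2<ν h ν bound = +-cancelˡ-≤ m (suc m) ν (begin
  m + suc m   ≡⟨ +-suc m m ⟩
  suc (m + m) ≡⟨ cong (λ k → suc (m + k)) (sym (+-identityʳ m)) ⟩
  suc (2 * m) ≡⟨ cong suc (*-comm 2 m) ⟩
  suc (m * 2) ≤⟨ s≤s (m/n*n≤m (h + 1) 2) ⟩
  suc (h + 1) ≡⟨ cong suc (+-comm h 1) ⟩
  2 + h       ≤⟨ bound ⟩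
  m + ν       ∎)
  where
  open ≤-Reasoning
  m : ℕ
  m = (h + 1) / 2

lemma19 : (n h : ℕ) → 2 ≤ n → 2 ≤ h → h % 2 ≡ 1 →
    (p : Profile n h) (m mr : ℕ) →
    IsMu p m → IsMu (rev p) mr →
    m ≡ (h + 1) / 2 →
    (∀ x → (InD m p x → InD mr (rev p) x) × (InD mr (rev p) x → InD m p x)) →
    (h + 1) / 2 < mr
lemma19 (suc (suc _)) h (s≤s (s≤s _)) _ _ p m mr (_ , (x , x∈D) , _) _ refl D⊆Dʳ =
  2+h≤[h+1]/2+ν⇒[h+1]/2<ν h mr
    (InD∧InD-rev⇒2+h≤μ+ν p (punchInᵢ≢i x F.zero ∘ sym) x∈D (proj₁ (D⊆Dʳ x) x∈D))
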